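{- Let $p$ be a prime and $n\geq 1$ an integer. If $A_n\in \operatorname{GL}(2,\mathbb{Z}/p^n\mathbb{Z})$ is a matrix whose order is divisible by $\varphi(p^{n+1})=p^n(p-1)$, then $\det(A_n)$ is a square modulo $p$.
   Context: $\varphi$ is Euler's totient function. -}

module Defs where

open import Data.Nat as ℕ using (ℕ; zero; suc)
open import Data.Integer using (ℤ; +_; _+_; _-_; _*_; 0ℤ; 1ℤ)
open import Data.Integer.Divisibility using (_∣_)
open import Data.Product using (_×_; ∃)
open import Relation.Nullary using (¬_)

infix 4 _≡_[mod_] _≈_[mod_]
_≡_[mod_] : ℤ → ℤ → ℕ → Set
a ≡ b [mod m ] = (+ m) ∣ (a - b)

-- 2×2 integer matrices (entries are representatives of classes in ℤ/mℤ)
record Mat2 : Set where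
  constructor mat
  field
    a b c d : ℤ
open Mat2 public

det : Mat2 → ℤ
det (mat a b c d) = a * d - b * c

_⊗_ : Mat2 → Mat2 → Mat2
mat a b c d ⊗ mat a' b' c' d' =
  mat (a * a' + b * c') (a * b' + b * d') (c * a' + d * c') (c * b' + d * d')

I₂ : Mat2
I₂ = mat 1ℤ 0ℤ 0ℤ 1ℤ

_^ᴹ_ : Mat2 → ℕ → Mat2
A ^ᴹ zero = I₂
A ^ᴹ suc k = A ⊗ (A ^ᴹ k)

_≈_[mod_] : Mat2 → Mat2 → ℕ → Set
A ≈ B [mod m ] =
  (a A ≡ a B [mod m ]) × (b A ≡ b B [mod m ]) ×
  (c A ≡ c B [mod m ]) × (d A ≡ d B [mod m ])

InGL2 : ℕ → Mat2 → Set
InGL2 m A = ∃ λ (u : ℤ) → det A * u ≡ 1ℤ [mod m ]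

IsOrder : ℕ → Mat2 → ℕ → Set
IsOrder m A k =
  (1 ℕ.≤ k) × ((A ^ᴹ k) ≈ I₂ [mod m ]) ×
  (∀ j → 1 ℕ.≤ j → j ℕ.< k → ¬ ((A ^ᴹ j) ≈ I₂ [mod m ]))

IsSquareMod : ℕ → ℤ → Set
IsSquareMod m x = ∃ λ (y : ℤ) → y * y ≡ x [mod m ]

-- For p = 2 every residue is a square, so let p = 2r + 1 be odd. Write
-- 2A = (tr A)·I + N, where N² = disc A · I and disc A = (tr A)² − 4 det A.
-- If p ∤ disc A, Frobenius in the commutative ring generated by I and N gives
-- 2Aᵖ ≡ (tr A)·I + (disc A)ʳ·N (mod p), and (disc A)ʳ ≡ ±1 by Euler's
-- criterion; so Aᵖ ≡ A or Aᵖ ≡ adj A, and in both cases A^(p²−1) ≡ I (mod p).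
-- Since Bᵖ − I = (B − I)(I + B + ⋯ + B^(p−1)), a congruence B ≡ I (mod pⁱ)
-- lifts to Bᵖ ≡ I (mod pⁱ⁺¹); hence A^(pⁿ⁻¹(p²−1)) ≡ I (mod pⁿ) and the order
-- of A is not divisible by pⁿ. So p ∣ disc A, and then
-- det A ≡ (tr A / 2)² (mod p).

module Submission where

open import Defs
open import Level using (0ℓ)
open import Algebra.Bundles using (Semiring)
open import Algebra.Structures using (IsSemiring)
open import Algebra.Core using (Op₂)
open import Algebra.Definitions using (Congruent₂)
open import Data.Nat as ℕ using (ℕ; zero; suc; _∸_; z≤n; s≤s; _!)
import Data.Nat.Properties as ℕ
import Data.Nat.Divisibility as ℕ
open import Data.Nat.DivMod using (m*[n/m]≡n; m≡m%n+[m/n]*n; m%n<n)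
open import Data.Nat.Combinatorics using (_C_; nCn≡1; nCk≡n!/k![n-k]!; k![n∸k]!∣n!)
open import Data.Nat.Primality
  using (Prime; ¬prime[0]; ¬prime[1]; prime[2]; euclidsLemma; prime⇒irreducible; prime⇒nonZero;
         prime⇒nonTrivial)
open import Data.Fin using (zero; suc; toℕ; fromℕ; inject₁)
open import Data.Fin.Properties using (toℕ-fromℕ; toℕ-inject₁; toℕ<n)
open import Data.Vec.Functional using (init; last; tail)
open import Data.List using (_∷_; [])
open import Data.Product using (_,_; ∃)
open import Data.Sum as Sum using (_⊎_; inj₁; inj₂)
open import Data.Empty using (⊥-elim)
open import Function using (_∘_; _∋_)
open import Relation.Binary using (Rel; IsEquivalence)
open import Relation.Binary.PropositionalEquality as ≡ using (_≡_; refl; cong; cong₂; subst)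
open import Relation.Nullary using (¬_; yes; no)

variable
  m n p : ℕ

prime>1 : Prime p → 1 ℕ.< p
prime>1 {p} pp = ℕ.nonTrivial⇒n>1 p {{prime⇒nonTrivial pp}}

prime∤! : Prime p → m ℕ.< p → ¬ p ℕ.∣ m !
prime∤! {m = zero}  pp _   p∣1 = ℕ.<⇒≢ (prime>1 pp) (≡.sym (ℕ.∣1⇒≡1 p∣1))
prime∤! {m = suc m} pp m<p p∣m! with euclidsLemma (suc m) (m !) pp p∣m!
... | inj₁ p∣m+1 = ℕ.<⇒≱ m<p (ℕ.∣⇒≤ p∣m+1)
... | inj₂ p∣m!  = prime∤! pp (ℕ.<-trans (ℕ.n<1+n m) m<p) p∣m!

prime∣pCk : ∀ {k} → Prime p → 0 ℕ.< k → k ℕ.< p → p ℕ.∣ p C k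
prime∣pCk {suc q} {k} pp 0<k k<p with euclidsLemma (k ! ℕ.* (suc q ∸ k) !) (suc q C k) pp p∣k![p-k]!C
  where
  k≤p = ℕ.<⇒≤ k<p
  instance _ = k ℕ.!* (suc q ∸ k) !≢0
  k![p-k]!C≡p! : k ! ℕ.* (suc q ∸ k) ! ℕ.* (suc q C k) ≡ suc q !
  k![p-k]!C≡p! = ≡.trans (cong (k ! ℕ.* (suc q ∸ k) ! ℕ.*_) (nCk≡n!/k![n-k]! k≤p))
                       (m*[n/m]≡n (k![n∸k]!∣n! k≤p))
  p∣k![p-k]!C : suc q ℕ.∣ k ! ℕ.* (suc q ∸ k) ! ℕ.* (suc q C k)
  p∣k![p-k]!C = subst (suc q ℕ.∣_) (≡.sym k![p-k]!C≡p!) (ℕ.m∣m*n (q !))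
... | inj₂ p∣C = p∣C
... | inj₁ p∣k![p-k]! with euclidsLemma (k !) ((suc q ∸ k) !) pp p∣k![p-k]!
...   | inj₁ p∣k!     = ⊥-elim (prime∤! pp k<p p∣k!)
...   | inj₂ p∣[p-k]! = ⊥-elim (prime∤! pp (ℕ.∸-monoʳ-< 0<k (ℕ.<⇒≤ k<p)) p∣[p-k]!)

-- Quotient semirings and the Frobenius map

module _ {a ℓ} {A : Set a} {_≈_ : Rel A ℓ} {_+_ _*_ : Op₂ A} {0# 1# : A} where

  quotient-isSemiring : IsEquivalence _≈_ → Congruent₂ _≈_ _+_ → Congruent₂ _≈_ _*_ →
                        IsSemiring _≡_ _+_ _*_ 0# 1# → IsSemiring _≈_ _+_ _*_ 0# 1#
  quotient-isSemiring ≈-isEquivalence +-cong *-cong isSemiring = record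
    { isSemiringWithoutAnnihilatingZero = record
      { +-isCommutativeMonoid = record
        { isMonoid = record
          { isSemigroup = record
            { isMagma = record { isEquivalence = ≈-isEquivalence ; ∙-cong = +-cong }
            ; assoc = λ x y z → ≈-reflexive (S.+-assoc x y z) }
          ; identity = ≈-reflexive ∘ S.+-identityˡ , ≈-reflexive ∘ S.+-identityʳ }
        ; comm = λ x y → ≈-reflexive (S.+-comm x y) }
      ; *-cong = *-cong
      ; *-assoc = λ x y z → ≈-reflexive (S.*-assoc x y z)
      ; *-identity = ≈-reflexive ∘ S.*-identityˡ , ≈-reflexive ∘ S.*-identityʳ
      ; distrib = (λ x y z → ≈-reflexive (S.distribˡ x y z))
                , (λ x y z → ≈-reflexive (S.distribʳ x y z)) }
    ; zero = ≈-reflexive ∘ S.zeroˡ , ≈-reflexive ∘ S.zeroʳ }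
    where
    module S = IsSemiring isSemiring
    ≈-reflexive = IsEquivalence.reflexive ≈-isEquivalence

module _ {c ℓ} (R : Semiring c ℓ) where

  open Semiring R hiding (refl; zero)
  open import Algebra.Properties.Semiring.Mult R using (_×_; ×-homo-1; ×-assoc-*; ×1-homo-*; ×-congʳ)
  open import Algebra.Properties.Semiring.Exp R using (_^_)
  open import Algebra.Properties.Semiring.Sum R using (sum; sum-cong-≋; sum-replicate-zero; sum-init-last)
  import Algebra.Properties.Semiring.Binomial as Binomial
  open import Relation.Binary.Reasoning.Setoid setoid

  ×≈×1#* : ∀ n a → n × a ≈ (n × 1#) * a
  ×≈×1#* n a = begin
    n × a        ≈⟨ ×-congʳ n (*-identityˡ a) ⟨
    n × (1# * a) ≈⟨ ×-assoc-* n 1# a ⟨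
    (n × 1#) * a ∎

  ∣⇒×≈0# : ∀ {p n} → p × 1# ≈ 0# → p ℕ.∣ n → ∀ a → n × a ≈ 0#
  ∣⇒×≈0# {p} p×1≈0 (ℕ.divides q refl) a = begin
    (q ℕ.* p) × a               ≈⟨ ×≈×1#* (q ℕ.* p) a ⟩
    ((q ℕ.* p) × 1#) * a        ≈⟨ *-congʳ (×1-homo-* q p) ⟩
    ((q × 1#) * (p × 1#)) * a   ≈⟨ *-congʳ (*-congˡ p×1≈0) ⟩
    ((q × 1#) * 0#) * a         ≈⟨ *-congʳ (zeroʳ (q × 1#)) ⟩
    0# * a                      ≈⟨ zeroˡ a ⟩
    0#                          ∎

  frobenius : ∀ {p} → Prime p → p × 1# ≈ 0# →
              ∀ {a b} → a * b ≈ b * a → (a + b) ^ p ≈ a ^ p + b ^ p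
  frobenius {zero}       pp = ⊥-elim (¬prime[0] pp)
  frobenius {p@(suc q)} pp p×1≈0 {a} {b} ab≈ba = begin
    (a + b) ^ p                                   ≈⟨ B.theorem ab≈ba p ⟩
    t zero + sum (tail t)                         ≈⟨ +-congˡ (sum-init-last (tail t)) ⟩
    t zero + (sum (init (tail t)) + last (tail t)) ≈⟨ +-cong first≈bᵖ (+-cong middle≈0 last≈aᵖ) ⟩
    b ^ p + (0# + a ^ p)                          ≈⟨ +-congˡ (+-identityˡ (a ^ p)) ⟩
    b ^ p + a ^ p                                 ≈⟨ +-comm (b ^ p) (a ^ p) ⟩
    a ^ p + b ^ p                                 ∎
    where
    module B = Binomial R a b
    t = B.binomialTerm p
    term : ∀ k j → toℕ k ≡ j → t k ≡ (p C j) × (a ^ j * b ^ (p ∸ j))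
    term k j refl = refl
    first≈bᵖ : t zero ≈ b ^ p
    first≈bᵖ = trans (×-homo-1 (1# * b ^ p)) (*-identityˡ (b ^ p))
    last≈aᵖ : last (tail t) ≈ a ^ p
    last≈aᵖ = begin
      last (tail t)                  ≡⟨ term (suc (fromℕ q)) p (cong suc (toℕ-fromℕ q)) ⟩
      (p C p) × (a ^ p * b ^ (p ∸ p)) ≡⟨ cong₂ (λ c e → c × (a ^ p * b ^ e)) (nCn≡1 p) (ℕ.n∸n≡0 p) ⟩
      1 × (a ^ p * 1#)                ≈⟨ ×-homo-1 (a ^ p * 1#) ⟩
      a ^ p * 1#                      ≈⟨ *-identityʳ (a ^ p) ⟩
      a ^ p                           ∎
    middle≈0 : sum (init (tail t)) ≈ 0#
    middle≈0 = trans (sum-cong-≋ term≈0) (sum-replicate-zero q)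
      where
      term≈0 : ∀ i → init (tail t) i ≈ 0#
      term≈0 i = trans
        (reflexive (term (suc (inject₁ i)) (suc (toℕ i)) (cong suc (toℕ-inject₁ i))))
        (∣⇒×≈0# p×1≈0 (prime∣pCk pp (s≤s z≤n) (s≤s (toℕ<n i))) _)

-- The ℤ operators are opened only inside this module, so that the ℕ operators
-- in the statement of lemma3p5 are unambiguous.
module _ where

  open import Data.Integer as ℤ using (ℤ; +_; -_; _+_; _-_; _*_; _^_; 0ℤ; 1ℤ)
  import Data.Integer.Properties as ℤ
  open import Data.Integer.Divisibility.Signed
    using (_∣_; _∣?_; divides; ∣-refl; ∣-trans; ∣ᵤ⇒∣; ∣⇒∣ᵤ; ∣m∣n⇒∣m+n; ∣m∣n⇒∣m-n; ∣m⇒∣-m; ∣n⇒∣m*n; ∣m⇒∣m*n)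
  import Algebra.Properties.Semiring.Exp as SemiringExp
  import Algebra.Properties.Semiring.Mult as SemiringMult
  import Relation.Binary.Reasoning.Setoid as SetoidReasoning
  open import Data.Integer.DivMod using (_%ℕ_; _/ℕ_; a≡a%ℕn+[a/ℕn]*n)
  open import Data.Integer.Tactic.RingSolver using (solve-∀; solve)

  variable
    j k r : ℕ
    x y z w s : ℤ
    A B X Y : Mat2

  euclidsLemmaℤ : Prime p → + p ∣ x * y → + p ∣ x ⊎ + p ∣ y
  euclidsLemmaℤ {x = x} {y = y} pp p∣xy =
    Sum.map ∣ᵤ⇒∣ ∣ᵤ⇒∣ (euclidsLemma ℤ.∣ x ∣ ℤ.∣ y ∣ pp (subst (_ ℕ.∣_) (ℤ.abs-* x y) (∣⇒∣ᵤ p∣xy)))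

  ∣0 : ∀ {k} → k ∣ 0ℤ
  ∣0 {k} = divides 0ℤ (≡.sym (ℤ.*-zeroˡ k))

  -- _≡_[mod_] unfolds to ℕ-divisibility of an absolute value, from which
  -- x, y and m cannot be inferred; wrapping it in a record restores inference.
  infix 4 _∼_[mod_]
  record _∼_[mod_] (x y : ℤ) (m : ℕ) : Set where
    constructor mod-∣
    field ∣-difference : + m ∣ x - y
  open _∼_[mod_] public

  ∼⇒≡[mod] : x ∼ y [mod m ] → x ≡ y [mod m ]
  ∼⇒≡[mod] (mod-∣ m∣x-y) = ∣⇒∣ᵤ m∣x-y

  ≡[mod]⇒∼ : x ≡ y [mod m ] → x ∼ y [mod m ]
  ≡[mod]⇒∼ m∣x-y = mod-∣ (∣ᵤ⇒∣ m∣x-y)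

  ∣⇒∼0 : + m ∣ x → x ∼ 0ℤ [mod m ]
  ∣⇒∼0 {x = x} m∣x = mod-∣ (subst (_ ∣_) (≡.sym (ℤ.+-identityʳ x)) m∣x)

  ∼0⇒∣ : x ∼ 0ℤ [mod m ] → + m ∣ x
  ∼0⇒∣ {x = x} (mod-∣ m∣x-0) = subst (_ ∣_) (ℤ.+-identityʳ x) m∣x-0

  ∼-reflexive : x ≡ y → x ∼ y [mod m ]
  ∼-reflexive {x = x} refl = mod-∣ (subst (_ ∣_) (≡.sym (ℤ.+-inverseʳ x)) ∣0)

  ∼-refl : x ∼ x [mod m ]
  ∼-refl = ∼-reflexive refl

  ∼-sym : x ∼ y [mod m ] → y ∼ x [mod m ]
  ∼-sym {x = x} {y = y} (mod-∣ h) = mod-∣ (subst (_ ∣_) eq (∣m⇒∣-m h))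
    where
    eq : - (x - y) ≡ y - x
    eq = solve (x ∷ y ∷ [])

  ∼-trans : x ∼ y [mod m ] → y ∼ z [mod m ] → x ∼ z [mod m ]
  ∼-trans {x = x} {y = y} {z = z} (mod-∣ h) (mod-∣ k) = mod-∣ (subst (_ ∣_) eq (∣m∣n⇒∣m+n h k))
    where
    eq : (x - y) + (y - z) ≡ x - z
    eq = solve (x ∷ y ∷ z ∷ [])

  ∼-isEquivalence : IsEquivalence (_∼_[mod m ])
  ∼-isEquivalence = record { refl = ∼-refl ; sym = ∼-sym ; trans = ∼-trans }

  +-cong-mod : x ∼ y [mod m ] → z ∼ w [mod m ] → x + z ∼ y + w [mod m ]
  +-cong-mod {x = x} {y = y} {z = z} {w = w} (mod-∣ h) (mod-∣ k) = mod-∣ (subst (_ ∣_) eq (∣m∣n⇒∣m+n h k))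
    where
    eq : (x - y) + (z - w) ≡ (x + z) - (y + w)
    eq = solve (x ∷ y ∷ z ∷ w ∷ [])

  *-cong-mod : x ∼ y [mod m ] → z ∼ w [mod m ] → x * z ∼ y * w [mod m ]
  *-cong-mod {x = x} {y = y} {z = z} {w = w} (mod-∣ h) (mod-∣ k) =
    mod-∣ (subst (_ ∣_) eq (∣m∣n⇒∣m+n (∣m⇒∣m*n z h) (∣n⇒∣m*n y k)))
    where
    eq : (x - y) * z + y * (z - w) ≡ x * z - y * w
    eq = solve (x ∷ y ∷ z ∷ w ∷ [])

  ^-cong-mod : ∀ k → x ∼ y [mod m ] → x ^ k ∼ y ^ k [mod m ]
  ^-cong-mod zero    x∼y = ∼-refl
  ^-cong-mod (suc k) x∼y = *-cong-mod x∼y (^-cong-mod k x∼y)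

  ∼-weaken : n ℕ.∣ m → x ∼ y [mod m ] → x ∼ y [mod n ]
  ∼-weaken n∣m (mod-∣ h) = mod-∣ (∣-trans (∣ᵤ⇒∣ n∣m) h)

  *-∼0 : x ∼ 0ℤ [mod m ] → y ∼ 0ℤ [mod n ] → x * y ∼ 0ℤ [mod m ℕ.* n ]
  *-∼0 {m = m} {n = n} x∼0 y∼0 with ∼0⇒∣ x∼0 | ∼0⇒∣ y∼0
  ... | divides q refl | divides r refl = ∣⇒∼0 (divides (q * r) eq)
    where
    eq : q * + m * (r * + n) ≡ q * r * + (m ℕ.* n)
    eq = ≡.trans (reorder q (+ m) r (+ n)) (cong (q * r *_) (≡.sym (ℤ.pos-* m n)))
      where
      reorder : ∀ a b c d → a * b * (c * d) ≡ a * c * (b * d)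
      reorder = solve-∀

  ℤ/_ : ℕ → Semiring 0ℓ 0ℓ
  ℤ/ m = record
    { _≈_        = _∼_[mod m ]
    ; isSemiring = quotient-isSemiring ∼-isEquivalence +-cong-mod *-cong-mod ℤ.+-*-isSemiring
    }

  module ℤ/-Exp {m : ℕ} = SemiringExp (ℤ/ m)
  module ℤ/-Mult {m : ℕ} = SemiringMult (ℤ/ m)

  module ∼-Reasoning {m : ℕ} = SetoidReasoning (Semiring.setoid (ℤ/ m))

  ℤ/-^≡^ : ∀ k → ℤ/-Exp._^_ {m} x k ≡ x ^ k
  ℤ/-^≡^ zero    = refl
  ℤ/-^≡^ {x = x} (suc k) = cong (x *_) (ℤ/-^≡^ k)

  ℤ/-×1≡+ : ∀ k → ℤ/-Mult._×_ {m} k 1ℤ ≡ + k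
  ℤ/-×1≡+ zero    = refl
  ℤ/-×1≡+ (suc k) = cong ℤ.suc (ℤ/-×1≡+ k)

  frobeniusℤ : Prime p → (x + y) ^ p ∼ x ^ p + y ^ p [mod p ]
  frobeniusℤ {p} {x} {y} pp = begin
    (x + y) ^ p                              ≡⟨ ℤ/-^≡^ p ⟨
    ℤ/-Exp._^_ (x + y) p                     ≈⟨ frobenius (ℤ/ p) pp p×1∼0 (∼-reflexive (ℤ.*-comm x y)) ⟩
    ℤ/-Exp._^_ x p + ℤ/-Exp._^_ y p          ≡⟨ cong₂ _+_ (ℤ/-^≡^ p) (ℤ/-^≡^ p) ⟩
    x ^ p + y ^ p                            ∎
    where
    open ∼-Reasoning
    p×1∼0 : ℤ/-Mult._×_ p 1ℤ ∼ 0ℤ [mod p ]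
    p×1∼0 = ∼-trans (∼-reflexive (ℤ/-×1≡+ p)) (∣⇒∼0 ∣-refl)

  fermatℕ : Prime p → ∀ k → (+ k) ^ p ∼ + k [mod p ]
  fermatℕ {zero}  pp = ⊥-elim (¬prime[0] pp)
  fermatℕ {suc q} pp zero    = ∼-reflexive (ℤ.*-zeroˡ (0ℤ ^ q))
  fermatℕ {p}     pp (suc k) = ∼-trans (frobeniusℤ pp)
    (+-cong-mod (∼-reflexive (ℤ.^-zeroˡ p)) (fermatℕ pp k))

  ∼-natural : .{{ℕ.NonZero m}} → ∀ x → ∃ λ k → x ∼ + k [mod m ]
  ∼-natural {m} x = x %ℕ m , mod-∣ (divides (x /ℕ m) eq)
    where
    eq : x - + (x %ℕ m) ≡ x /ℕ m * + m
    eq = ≡.trans (cong (_- + (x %ℕ m)) (a≡a%ℕn+[a/ℕn]*n x m)) (a+b-a≡b (+ (x %ℕ m)) (x /ℕ m * + m))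
      where
      a+b-a≡b : ∀ a b → a + b - a ≡ b
      a+b-a≡b = solve-∀

  fermat : Prime p → ∀ x → x ^ p ∼ x [mod p ]
  fermat {p} pp x with ∼-natural {{prime⇒nonZero pp}} x
  ... | k , x∼k = ∼-trans (^-cong-mod p x∼k) (∼-trans (fermatℕ pp k) (∼-sym x∼k))

  ∼-cancelˡ : Prime p → ¬ (+ p ∣ s) → s * x ∼ s * y [mod p ] → x ∼ y [mod p ]
  ∼-cancelˡ {s = s} {x = x} {y = y} pp p∤s (mod-∣ p∣sx-sy)
    with euclidsLemmaℤ pp (subst (_ ∣_) eq p∣sx-sy)
    where
    eq : s * x - s * y ≡ s * (x - y)
    eq = solve (s ∷ x ∷ y ∷ [])
  ... | inj₁ p∣s   = ⊥-elim (p∤s p∣s)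
  ... | inj₂ p∣x-y = mod-∣ p∣x-y

  fermat-∤ : Prime p → ¬ (+ p ∣ x) → x ^ (p ∸ 1) ∼ 1ℤ [mod p ]
  fermat-∤ {zero}  pp = ⊥-elim (¬prime[0] pp)
  fermat-∤ {suc q} {x} pp p∤x =
    ∼-cancelˡ pp p∤x (∼-trans (fermat pp x) (∼-reflexive (≡.sym (ℤ.*-identityʳ x))))

  square∼1⇒±1 : Prime p → x * x ∼ 1ℤ [mod p ] → x ∼ 1ℤ [mod p ] ⊎ x ∼ - 1ℤ [mod p ]
  square∼1⇒±1 {x = x} pp (mod-∣ p∣x²-1) =
    Sum.map mod-∣ mod-∣ (euclidsLemmaℤ pp (subst (_ ∣_) eq p∣x²-1))
    where
    eq : x * x - 1ℤ ≡ (x - 1ℤ) * (x - - 1ℤ)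
    eq = solve (x ∷ [])

  unit⇒∤ : Prime p → x * y ∼ 1ℤ [mod p ] → ¬ (+ p ∣ x)
  unit⇒∤ {x = x} {y = y} pp (mod-∣ p∣xy-1) p∣x =
    ℕ.<⇒≢ (prime>1 pp) (≡.sym (ℕ.∣1⇒≡1 (∣⇒∣ᵤ (subst (_ ∣_) eq (∣m∣n⇒∣m-n (∣m⇒∣m*n y p∣x) p∣xy-1)))))
    where
    eq : x * y - (x * y - 1ℤ) ≡ 1ℤ
    eq = solve (x ∷ y ∷ [])

  infixl 6 _⊕_
  _⊕_ : Mat2 → Mat2 → Mat2
  mat a b c d ⊕ mat a′ b′ c′ d′ = mat (a + a′) (b + b′) (c + c′) (d + d′)

  O₂ : Mat2
  O₂ = mat 0ℤ 0ℤ 0ℤ 0ℤ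

  mat-≡ : ∀ {a b c d a′ b′ c′ d′} → a ≡ a′ → b ≡ b′ → c ≡ c′ → d ≡ d′ →
          mat a b c d ≡ mat a′ b′ c′ d′
  mat-≡ refl refl refl refl = refl

  M₂-isSemiring : IsSemiring _≡_ _⊕_ _⊗_ O₂ I₂
  M₂-isSemiring = record
    { isSemiringWithoutAnnihilatingZero = record
      { +-isCommutativeMonoid = record
        { isMonoid = record
          { isSemigroup = record
            { isMagma = record { isEquivalence = ≡.isEquivalence ; ∙-cong = cong₂ _⊕_ }
            ; assoc = ⊕-assoc }
          ; identity = ⊕-identityˡ , ⊕-identityʳ }
        ; comm = ⊕-comm }
      ; *-cong = cong₂ _⊗_
      ; *-assoc = ⊗-assoc
      ; *-identity = ⊗-identityˡ , ⊗-identityʳ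
      ; distrib = ⊗-distribˡ , ⊗-distribʳ }
    ; zero = ⊗-zeroˡ , ⊗-zeroʳ }
    where
    ⊕-assoc : ∀ A B C → (A ⊕ B) ⊕ C ≡ A ⊕ (B ⊕ C)
    ⊕-assoc (mat a b c d) (mat e f g h) (mat i j k l) =
      mat-≡ (ℤ.+-assoc a e i) (ℤ.+-assoc b f j) (ℤ.+-assoc c g k) (ℤ.+-assoc d h l)
    ⊕-comm : ∀ A B → A ⊕ B ≡ B ⊕ A
    ⊕-comm (mat a b c d) (mat e f g h) =
      mat-≡ (ℤ.+-comm a e) (ℤ.+-comm b f) (ℤ.+-comm c g) (ℤ.+-comm d h)
    ⊕-identityˡ : ∀ A → O₂ ⊕ A ≡ A
    ⊕-identityˡ (mat a b c d) =
      mat-≡ (ℤ.+-identityˡ a) (ℤ.+-identityˡ b) (ℤ.+-identityˡ c) (ℤ.+-identityˡ d)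
    ⊕-identityʳ : ∀ A → A ⊕ O₂ ≡ A
    ⊕-identityʳ (mat a b c d) =
      mat-≡ (ℤ.+-identityʳ a) (ℤ.+-identityʳ b) (ℤ.+-identityʳ c) (ℤ.+-identityʳ d)
    ⊗-assoc : ∀ A B C → (A ⊗ B) ⊗ C ≡ A ⊗ (B ⊗ C)
    ⊗-assoc (mat a b c d) (mat e f g h) (mat i j k l) =
      mat-≡ (entry a b i k) (entry a b j l) (entry c d i k) (entry c d j l)
      where
      entry : ∀ x y u v →
              (x * e + y * g) * u + (x * f + y * h) * v ≡ x * (e * u + f * v) + y * (g * u + h * v)
      entry x y u v = solve (x ∷ y ∷ u ∷ v ∷ e ∷ f ∷ g ∷ h ∷ [])
    ⊗-identityˡ : ∀ A → I₂ ⊗ A ≡ A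
    ⊗-identityˡ (mat a b c d) = mat-≡ (entry a c) (entry b d) (entry′ a c) (entry′ b d)
      where
      entry : ∀ x y → 1ℤ * x + 0ℤ * y ≡ x
      entry x y = solve (x ∷ y ∷ [])
      entry′ : ∀ x y → 0ℤ * x + 1ℤ * y ≡ y
      entry′ x y = solve (x ∷ y ∷ [])
    ⊗-identityʳ : ∀ A → A ⊗ I₂ ≡ A
    ⊗-identityʳ (mat a b c d) = mat-≡ (entry a b) (entry′ a b) (entry c d) (entry′ c d)
      where
      entry : ∀ x y → x * 1ℤ + y * 0ℤ ≡ x
      entry x y = solve (x ∷ y ∷ [])
      entry′ : ∀ x y → x * 0ℤ + y * 1ℤ ≡ y
      entry′ x y = solve (x ∷ y ∷ [])
    ⊗-distribˡ : ∀ A B C → A ⊗ (B ⊕ C) ≡ A ⊗ B ⊕ A ⊗ C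
    ⊗-distribˡ (mat a b c d) (mat e f g h) (mat i j k l) =
      mat-≡ (entry a b e g i k) (entry a b f h j l) (entry c d e g i k) (entry c d f h j l)
      where
      entry : ∀ x y u v u′ v′ → x * (u + u′) + y * (v + v′) ≡ (x * u + y * v) + (x * u′ + y * v′)
      entry x y u v u′ v′ = solve (x ∷ y ∷ u ∷ v ∷ u′ ∷ v′ ∷ [])
    ⊗-distribʳ : ∀ A B C → (B ⊕ C) ⊗ A ≡ B ⊗ A ⊕ C ⊗ A
    ⊗-distribʳ (mat a b c d) (mat e f g h) (mat i j k l) =
      mat-≡ (entry e f i j a c) (entry e f i j b d) (entry g h k l a c) (entry g h k l b d)
      where
      entry : ∀ x y x′ y′ u v → (x + x′) * u + (y + y′) * v ≡ (x * u + y * v) + (x′ * u + y′ * v)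
      entry x y x′ y′ u v = solve (x ∷ y ∷ x′ ∷ y′ ∷ u ∷ v ∷ [])
    ⊗-zeroˡ : ∀ A → O₂ ⊗ A ≡ O₂
    ⊗-zeroˡ (mat a b c d) = mat-≡ (entry a c) (entry b d) (entry a c) (entry b d)
      where
      entry : ∀ x y → 0ℤ * x + 0ℤ * y ≡ 0ℤ
      entry x y = solve (x ∷ y ∷ [])
    ⊗-zeroʳ : ∀ A → A ⊗ O₂ ≡ O₂
    ⊗-zeroʳ (mat a b c d) = mat-≡ (entry a b) (entry a b) (entry c d) (entry c d)
      where
      entry : ∀ x y → x * 0ℤ + y * 0ℤ ≡ 0ℤ
      entry x y = solve (x ∷ y ∷ [])

  M₂ : Semiring 0ℓ 0ℓ
  M₂ = record { isSemiring = M₂-isSemiring }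

  module M₂ = Semiring M₂

  infix 4 _≋_[mod_]
  record _≋_[mod_] (A B : Mat2) (m : ℕ) : Set where
    constructor entrywise
    field
      a∼ : a A ∼ a B [mod m ]
      b∼ : b A ∼ b B [mod m ]
      c∼ : c A ∼ c B [mod m ]
      d∼ : d A ∼ d B [mod m ]

  ≋⇒≈[mod] : A ≋ B [mod m ] → A ≈ B [mod m ]
  ≋⇒≈[mod] (entrywise a∼ b∼ c∼ d∼) = ∼⇒≡[mod] a∼ , ∼⇒≡[mod] b∼ , ∼⇒≡[mod] c∼ , ∼⇒≡[mod] d∼

  ≈[mod]⇒≋ : A ≈ B [mod m ] → A ≋ B [mod m ]
  ≈[mod]⇒≋ (a≡ , b≡ , c≡ , d≡) = entrywise (≡[mod]⇒∼ a≡) (≡[mod]⇒∼ b≡) (≡[mod]⇒∼ c≡) (≡[mod]⇒∼ d≡)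

  ≋-reflexive : A ≡ B → A ≋ B [mod m ]
  ≋-reflexive refl = entrywise ∼-refl ∼-refl ∼-refl ∼-refl

  ≋-isEquivalence : IsEquivalence (_≋_[mod m ])
  ≋-isEquivalence = record
    { refl  = ≋-reflexive refl
    ; sym   = λ (entrywise a∼ b∼ c∼ d∼) → entrywise (∼-sym a∼) (∼-sym b∼) (∼-sym c∼) (∼-sym d∼)
    ; trans = λ (entrywise a∼ b∼ c∼ d∼) (entrywise a∼′ b∼′ c∼′ d∼′) →
                entrywise (∼-trans a∼ a∼′) (∼-trans b∼ b∼′) (∼-trans c∼ c∼′) (∼-trans d∼ d∼′)
    }

  ⊕-cong-mod : A ≋ B [mod m ] → X ≋ Y [mod m ] → A ⊕ X ≋ B ⊕ Y [mod m ]
  ⊕-cong-mod (entrywise a∼ b∼ c∼ d∼) (entrywise a∼′ b∼′ c∼′ d∼′) =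
    entrywise (+-cong-mod a∼ a∼′) (+-cong-mod b∼ b∼′) (+-cong-mod c∼ c∼′) (+-cong-mod d∼ d∼′)

  ⊗-cong-mod : A ≋ B [mod m ] → X ≋ Y [mod m ] → A ⊗ X ≋ B ⊗ Y [mod m ]
  ⊗-cong-mod (entrywise a∼ b∼ c∼ d∼) (entrywise a∼′ b∼′ c∼′ d∼′) = entrywise
    (+-cong-mod (*-cong-mod a∼ a∼′) (*-cong-mod b∼ c∼′)) (+-cong-mod (*-cong-mod a∼ b∼′) (*-cong-mod b∼ d∼′))
    (+-cong-mod (*-cong-mod c∼ a∼′) (*-cong-mod d∼ c∼′)) (+-cong-mod (*-cong-mod c∼ b∼′) (*-cong-mod d∼ d∼′))

  M₂/_ : ℕ → Semiring 0ℓ 0ℓ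
  M₂/ m = record
    { _≈_        = _≋_[mod m ]
    ; isSemiring = quotient-isSemiring ≋-isEquivalence ⊕-cong-mod ⊗-cong-mod M₂-isSemiring
    }

  module M₂/ {m} = Semiring (M₂/ m)
  module ≋-Reasoning {m : ℕ} = SetoidReasoning (M₂/.setoid {m})

  ⊗-≋O₂ : A ≋ O₂ [mod m ] → B ≋ O₂ [mod n ] → A ⊗ B ≋ O₂ [mod m ℕ.* n ]
  ⊗-≋O₂ (entrywise a∼ b∼ c∼ d∼) (entrywise a∼′ b∼′ c∼′ d∼′) = entrywise
    (+-cong-mod (*-∼0 a∼ a∼′) (*-∼0 b∼ c∼′)) (+-cong-mod (*-∼0 a∼ b∼′) (*-∼0 b∼ d∼′))
    (+-cong-mod (*-∼0 c∼ a∼′) (*-∼0 d∼ c∼′)) (+-cong-mod (*-∼0 c∼ b∼′) (*-∼0 d∼ d∼′))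

  scalar : ℤ → Mat2
  scalar x = mat x 0ℤ 0ℤ x

  infixr 7 _·_
  _·_ : ℤ → Mat2 → Mat2
  s · mat a b c d = mat (s * a) (s * b) (s * c) (s * d)

  scalar-cong-mod : x ∼ y [mod m ] → scalar x ≋ scalar y [mod m ]
  scalar-cong-mod x∼y = entrywise x∼y ∼-refl ∼-refl x∼y

  ·-cong-mod : x ∼ y [mod m ] → A ≋ B [mod m ] → x · A ≋ y · B [mod m ]
  ·-cong-mod x∼y (entrywise a∼ b∼ c∼ d∼) =
    entrywise (*-cong-mod x∼y a∼) (*-cong-mod x∼y b∼) (*-cong-mod x∼y c∼) (*-cong-mod x∼y d∼)

  ·-cancelˡ : Prime p → ¬ (+ p ∣ s) → s · A ≋ s · B [mod p ] → A ≋ B [mod p ]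
  ·-cancelˡ pp p∤s (entrywise a∼ b∼ c∼ d∼) = entrywise
    (∼-cancelˡ pp p∤s a∼) (∼-cancelˡ pp p∤s b∼) (∼-cancelˡ pp p∤s c∼) (∼-cancelˡ pp p∤s d∼)

  ·-identityˡ : ∀ A → 1ℤ · A ≡ A
  ·-identityˡ (mat a b c d) = mat-≡ (ℤ.*-identityˡ a) (ℤ.*-identityˡ b) (ℤ.*-identityˡ c) (ℤ.*-identityˡ d)

  scalar-⊗ : ∀ s A → scalar s ⊗ A ≡ s · A
  scalar-⊗ s (mat a b c d) = mat-≡ (entry a c) (entry b d) (entry′ a c) (entry′ b d)
    where
    entry : ∀ x y → s * x + 0ℤ * y ≡ s * x
    entry x y = solve (s ∷ x ∷ y ∷ [])
    entry′ : ∀ x y → 0ℤ * x + s * y ≡ s * y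
    entry′ x y = solve (s ∷ x ∷ y ∷ [])

  ⊗-scalar : ∀ s A → A ⊗ scalar s ≡ s · A
  ⊗-scalar s (mat a b c d) = mat-≡ (entry a b) (entry′ a b) (entry c d) (entry′ c d)
    where
    entry : ∀ x y → x * s + y * 0ℤ ≡ s * x
    entry x y = solve (s ∷ x ∷ y ∷ [])
    entry′ : ∀ x y → x * 0ℤ + y * s ≡ s * y
    entry′ x y = solve (s ∷ x ∷ y ∷ [])

  scalar-comm : ∀ s A → scalar s ⊗ A ≡ A ⊗ scalar s
  scalar-comm s A = ≡.trans (scalar-⊗ s A) (≡.sym (⊗-scalar s A))

  ·-scalar : ∀ s x → s · scalar x ≡ scalar (s * x)
  ·-scalar s x = mat-≡ refl (ℤ.*-zeroʳ s) (ℤ.*-zeroʳ s) refl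

  ·-⊗-· : ∀ s t A B → (s · A) ⊗ (t · B) ≡ (s * t) · (A ⊗ B)
  ·-⊗-· s t (mat a b c d) (mat e f g h) =
    mat-≡ (entry a b e g) (entry a b f h) (entry c d e g) (entry c d f h)
    where
    entry : ∀ x y u v → s * x * (t * u) + s * y * (t * v) ≡ s * t * (x * u + y * v)
    entry x y u v = solve (s ∷ t ∷ x ∷ y ∷ u ∷ v ∷ [])

  ^ᴹ-+ : ∀ A i j → A ^ᴹ (i ℕ.+ j) ≡ (A ^ᴹ i) ⊗ (A ^ᴹ j)
  ^ᴹ-+ A zero    j = ≡.sym (M₂.*-identityˡ (A ^ᴹ j))
  ^ᴹ-+ A (suc i) j = ≡.trans (cong (A ⊗_) (^ᴹ-+ A i j)) (≡.sym (M₂.*-assoc A (A ^ᴹ i) (A ^ᴹ j)))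

  ^ᴹ-* : ∀ A i j → A ^ᴹ (i ℕ.* j) ≡ (A ^ᴹ j) ^ᴹ i
  ^ᴹ-* A zero    j = refl
  ^ᴹ-* A (suc i) j = ≡.trans (^ᴹ-+ A j (i ℕ.* j)) (cong ((A ^ᴹ j) ⊗_) (^ᴹ-* A i j))

  ^ᴹ-suc : ∀ A i → A ^ᴹ suc i ≡ (A ^ᴹ i) ⊗ A
  ^ᴹ-suc A i =
    ≡.trans (cong (A ^ᴹ_) (ℕ.+-comm 1 i)) (≡.trans (^ᴹ-+ A i 1) (cong ((A ^ᴹ i) ⊗_) (M₂.*-identityʳ A)))

  ^ᴹ-cong-mod : ∀ i → A ≋ B [mod m ] → A ^ᴹ i ≋ B ^ᴹ i [mod m ]
  ^ᴹ-cong-mod zero    A≋B = ≋-reflexive refl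
  ^ᴹ-cong-mod (suc i) A≋B = ⊗-cong-mod A≋B (^ᴹ-cong-mod i A≋B)

  I₂-^ᴹ : ∀ i → I₂ ^ᴹ i ≡ I₂
  I₂-^ᴹ zero    = refl
  I₂-^ᴹ (suc i) = ≡.trans (cong (I₂ ⊗_) (I₂-^ᴹ i)) (M₂.*-identityˡ I₂)

  ^ᴹ-≋I₂ : ∀ i → A ≋ I₂ [mod m ] → A ^ᴹ i ≋ I₂ [mod m ]
  ^ᴹ-≋I₂ i A≋I₂ = M₂/.trans (^ᴹ-cong-mod i A≋I₂) (≋-reflexive (I₂-^ᴹ i))

  ·-^ᴹ : ∀ s A i → (s · A) ^ᴹ i ≡ s ^ i · A ^ᴹ i
  ·-^ᴹ s A zero    = refl
  ·-^ᴹ s A (suc i) = ≡.trans (cong ((s · A) ⊗_) (·-^ᴹ s A i)) (·-⊗-· s (s ^ i) A (A ^ᴹ i))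

  scalar-^ᴹ : ∀ x i → scalar x ^ᴹ i ≡ scalar (x ^ i)
  scalar-^ᴹ x zero    = refl
  scalar-^ᴹ x (suc i) =
    ≡.trans (cong (scalar x ⊗_) (scalar-^ᴹ x i)) (≡.trans (scalar-⊗ x (scalar (x ^ i))) (·-scalar x (x ^ i)))

  ^ᴹ-even : X ⊗ X ≡ scalar s → ∀ r → X ^ᴹ (r ℕ.+ r) ≡ scalar (s ^ r)
  ^ᴹ-even X²≡s zero    = refl
  ^ᴹ-even {X} {s} X²≡s (suc r) = begin
    X ^ᴹ (suc r ℕ.+ suc r)           ≡⟨ cong (λ k → X ⊗ (X ^ᴹ k)) (ℕ.+-suc r r) ⟩
    X ⊗ (X ⊗ (X ^ᴹ (r ℕ.+ r)))      ≡⟨ M₂.*-assoc X X (X ^ᴹ (r ℕ.+ r)) ⟨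
    (X ⊗ X) ⊗ (X ^ᴹ (r ℕ.+ r))      ≡⟨ cong₂ _⊗_ X²≡s (^ᴹ-even X²≡s r) ⟩
    scalar s ⊗ scalar (s ^ r)        ≡⟨ scalar-⊗ s (scalar (s ^ r)) ⟩
    s · scalar (s ^ r)               ≡⟨ ·-scalar s (s ^ r) ⟩
    scalar (s ^ suc r)               ∎
    where open ≡.≡-Reasoning

  module M₂/-Exp {m : ℕ} = SemiringExp (M₂/ m)
  module M₂/-Mult {m : ℕ} = SemiringMult (M₂/ m)

  ^ᴹ≡M₂/-^ : ∀ A i → A ^ᴹ i ≡ M₂/-Exp._^_ {m} A i
  ^ᴹ≡M₂/-^ A zero    = refl
  ^ᴹ≡M₂/-^ A (suc i) = cong (A ⊗_) (^ᴹ≡M₂/-^ A i)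

  M₂/-×I₂≡scalar : ∀ k → M₂/-Mult._×_ {m} k I₂ ≡ scalar (+ k)
  M₂/-×I₂≡scalar zero    = refl
  M₂/-×I₂≡scalar (suc k) = cong (I₂ ⊕_) (M₂/-×I₂≡scalar k)

  frobeniusᴹ : Prime p → A ⊗ B ≡ B ⊗ A → (A ⊕ B) ^ᴹ p ≋ (A ^ᴹ p) ⊕ (B ^ᴹ p) [mod p ]
  frobeniusᴹ {p} {A} {B} pp AB≡BA = begin
    (A ⊕ B) ^ᴹ p                         ≡⟨ ^ᴹ≡M₂/-^ (A ⊕ B) p ⟩
    M₂/-Exp._^_ (A ⊕ B) p                ≈⟨ frobenius (M₂/ p) pp p×I₂≋O₂ (≋-reflexive AB≡BA) ⟩
    M₂/-Exp._^_ A p ⊕ M₂/-Exp._^_ B p    ≡⟨ cong₂ _⊕_ (^ᴹ≡M₂/-^ A p) (^ᴹ≡M₂/-^ B p) ⟨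
    (A ^ᴹ p) ⊕ (B ^ᴹ p)                  ∎
    where
    open ≋-Reasoning
    p×I₂≋O₂ : M₂/-Mult._×_ p I₂ ≋ O₂ [mod p ]
    p×I₂≋O₂ = M₂/.trans (≋-reflexive (M₂/-×I₂≡scalar p)) (scalar-cong-mod (∣⇒∼0 ∣-refl))

  -- The Frobenius of a 2×2 matrix modulo an odd prime

  adj : Mat2 → Mat2
  adj (mat a b c d) = mat d (- b) (- c) a

  tr : Mat2 → ℤ
  tr (mat a b c d) = a + d

  disc : Mat2 → ℤ
  disc A = tr A * tr A - + 4 * det A

  twiceTraceless : Mat2 → Mat2
  twiceTraceless (mat a b c d) = mat (a - d) (+ 2 * b) (+ 2 * c) (d - a)

  ⊗-adj : ∀ A → A ⊗ adj A ≡ scalar (det A)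
  ⊗-adj (mat a b c d) = mat-≡
    (a * d + b * - c ≡ a * d - b * c ∋ solve (a ∷ b ∷ c ∷ d ∷ []))
    (a * - b + b * a ≡ 0ℤ            ∋ solve (a ∷ b ∷ []))
    (c * d + d * - c ≡ 0ℤ            ∋ solve (c ∷ d ∷ []))
    (c * - b + d * a ≡ a * d - b * c ∋ solve (a ∷ b ∷ c ∷ d ∷ []))

  adj-⊗ : ∀ A → adj A ⊗ A ≡ scalar (det A)
  adj-⊗ (mat a b c d) = mat-≡
    (d * a + - b * c ≡ a * d - b * c ∋ solve (a ∷ b ∷ c ∷ d ∷ []))
    (d * b + - b * d ≡ 0ℤ            ∋ solve (b ∷ d ∷ []))
    (- c * a + a * c ≡ 0ℤ            ∋ solve (a ∷ c ∷ []))
    (- c * b + a * d ≡ a * d - b * c ∋ solve (a ∷ b ∷ c ∷ d ∷ []))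

  two·≡tr+twiceTraceless : ∀ A → + 2 · A ≡ scalar (tr A) ⊕ twiceTraceless A
  two·≡tr+twiceTraceless (mat a b c d) = mat-≡
    (+ 2 * a ≡ (a + d) + (a - d) ∋ solve (a ∷ d ∷ []))
    (≡.sym (ℤ.+-identityˡ (+ 2 * b)))
    (≡.sym (ℤ.+-identityˡ (+ 2 * c)))
    (+ 2 * d ≡ (a + d) + (d - a) ∋ solve (a ∷ d ∷ []))

  two·adj≡tr-twiceTraceless : ∀ A → + 2 · adj A ≡ scalar (tr A) ⊕ - 1ℤ · twiceTraceless A
  two·adj≡tr-twiceTraceless (mat a b c d) = mat-≡
    (+ 2 * d ≡ (a + d) + - 1ℤ * (a - d)       ∋ solve (a ∷ d ∷ []))
    (+ 2 * - b ≡ 0ℤ + - 1ℤ * (+ 2 * b)        ∋ solve (b ∷ []))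
    (+ 2 * - c ≡ 0ℤ + - 1ℤ * (+ 2 * c)        ∋ solve (c ∷ []))
    (+ 2 * a ≡ (a + d) + - 1ℤ * (d - a)       ∋ solve (a ∷ d ∷ []))

  twiceTraceless² : ∀ A → twiceTraceless A ⊗ twiceTraceless A ≡ scalar (disc A)
  twiceTraceless² (mat a b c d) = mat-≡
    ((a - d) * (a - d) + + 2 * b * (+ 2 * c) ≡ (a + d) * (a + d) - + 4 * (a * d - b * c)
       ∋ solve (a ∷ b ∷ c ∷ d ∷ []))
    ((a - d) * (+ 2 * b) + + 2 * b * (d - a) ≡ 0ℤ ∋ solve (a ∷ b ∷ d ∷ []))
    (+ 2 * c * (a - d) + (d - a) * (+ 2 * c) ≡ 0ℤ ∋ solve (a ∷ c ∷ d ∷ []))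
    (+ 2 * c * (+ 2 * b) + (d - a) * (d - a) ≡ (a + d) * (a + d) - + 4 * (a * d - b * c)
       ∋ solve (a ∷ b ∷ c ∷ d ∷ []))

  ⊗-cancelʳ : Prime p → ¬ (+ p ∣ det A) → X ⊗ A ≋ Y ⊗ A [mod p ] → X ≋ Y [mod p ]
  ⊗-cancelʳ {A = A} {X = X} {Y = Y} pp p∤detA XA≋YA = ·-cancelˡ pp p∤detA (begin
    det A · X                ≡⟨ ⊗-scalar (det A) X ⟨
    X ⊗ scalar (det A)       ≡⟨ cong (X ⊗_) (⊗-adj A) ⟨
    X ⊗ (A ⊗ adj A)          ≡⟨ M₂.*-assoc X A (adj A) ⟨
    (X ⊗ A) ⊗ adj A          ≈⟨ ⊗-cong-mod XA≋YA (≋-reflexive refl) ⟩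
    (Y ⊗ A) ⊗ adj A          ≡⟨ M₂.*-assoc Y A (adj A) ⟩
    Y ⊗ (A ⊗ adj A)          ≡⟨ cong (Y ⊗_) (⊗-adj A) ⟩
    Y ⊗ scalar (det A)       ≡⟨ ⊗-scalar (det A) Y ⟩
    det A · Y                ∎)
    where open ≋-Reasoning

  odd-prime∤2 : Prime p → p ≡ suc (r ℕ.+ r) → ¬ (+ p ∣ + 2)
  odd-prime∤2 {r = zero}  pp refl = ⊥-elim (¬prime[1] pp)
  odd-prime∤2 {r = suc r} pp refl p∣2 =
    ℕ.<⇒≱ (s≤s (s≤s (ℕ.≤-trans (s≤s z≤n) (ℕ.m≤n+m (suc r) r)))) (ℕ.∣⇒≤ (∣⇒∣ᵤ p∣2))

  euler-±1 : Prime p → p ≡ suc (r ℕ.+ r) → ¬ (+ p ∣ x) → x ^ r ∼ 1ℤ [mod p ] ⊎ x ^ r ∼ - 1ℤ [mod p ]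
  euler-±1 {r = r} {x = x} pp refl p∤x =
    square∼1⇒±1 pp (∼-trans (∼-reflexive (≡.sym (ℤ.^-distribˡ-+-* x r r))) (fermat-∤ pp p∤x))

  two·^ᴹ≋ : Prime p → p ≡ suc (r ℕ.+ r) → disc A ^ r ∼ s [mod p ] →
            + 2 · (A ^ᴹ p) ≋ scalar (tr A) ⊕ s · twiceTraceless A [mod p ]
  two·^ᴹ≋ {p} {r} {A} {s} pp refl Dʳ∼s = begin
    + 2 · (A ^ᴹ p)                    ≈⟨ ·-cong-mod (∼-sym (fermat pp (+ 2))) (≋-reflexive refl) ⟩
    (+ 2) ^ p · (A ^ᴹ p)              ≡⟨ ·-^ᴹ (+ 2) A p ⟨
    (+ 2 · A) ^ᴹ p                    ≡⟨ cong (_^ᴹ p) (two·≡tr+twiceTraceless A) ⟩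
    (scalar t ⊕ N) ^ᴹ p               ≈⟨ frobeniusᴹ {A = scalar t} {B = N} pp (scalar-comm t N) ⟩
    (scalar t ^ᴹ p) ⊕ (N ^ᴹ p)        ≡⟨ cong₂ _⊕_ (scalar-^ᴹ t p) Nᵖ ⟩
    scalar (t ^ p) ⊕ disc A ^ r · N   ≈⟨ ⊕-cong-mod (scalar-cong-mod (fermat pp t))
                                                    (·-cong-mod Dʳ∼s (≋-reflexive refl)) ⟩
    scalar t ⊕ s · N                  ∎
    where
    open ≋-Reasoning
    t = tr A
    N = twiceTraceless A
    Nᵖ : N ^ᴹ p ≡ disc A ^ r · N
    Nᵖ = ≡.trans (cong (N ⊗_) (^ᴹ-even (twiceTraceless² A) r)) (⊗-scalar (disc A ^ r) N)

  frobenius-2×2 : Prime p → p ≡ suc (r ℕ.+ r) → ¬ (+ p ∣ disc A) →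
                  A ^ᴹ p ≋ A [mod p ] ⊎ A ^ᴹ p ≋ adj A [mod p ]
  frobenius-2×2 {p} {r} {A} pp p-odd p∤D = Sum.map Aᵖ≋A Aᵖ≋adjA (euler-±1 {r = r} pp p-odd p∤D)
    where
    open ≋-Reasoning
    N = twiceTraceless A
    cancel-2 : + 2 · (A ^ᴹ p) ≋ + 2 · B [mod p ] → A ^ᴹ p ≋ B [mod p ]
    cancel-2 = ·-cancelˡ pp (odd-prime∤2 {r = r} pp p-odd)
    Aᵖ≋A : disc A ^ r ∼ 1ℤ [mod p ] → A ^ᴹ p ≋ A [mod p ]
    Aᵖ≋A Dʳ∼1 = cancel-2 (begin
      + 2 · (A ^ᴹ p)            ≈⟨ two·^ᴹ≋ {r = r} pp p-odd Dʳ∼1 ⟩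
      scalar (tr A) ⊕ 1ℤ · N    ≡⟨ cong (scalar (tr A) ⊕_) (·-identityˡ N) ⟩
      scalar (tr A) ⊕ N         ≡⟨ two·≡tr+twiceTraceless A ⟨
      + 2 · A                   ∎)
    Aᵖ≋adjA : disc A ^ r ∼ - 1ℤ [mod p ] → A ^ᴹ p ≋ adj A [mod p ]
    Aᵖ≋adjA Dʳ∼-1 = cancel-2 (begin
      + 2 · (A ^ᴹ p)            ≈⟨ two·^ᴹ≋ {r = r} pp p-odd Dʳ∼-1 ⟩
      scalar (tr A) ⊕ - 1ℤ · N  ≡⟨ two·adj≡tr-twiceTraceless A ⟨
      + 2 · adj A               ∎)

  ^ᴹ[p²-1]≋I₂ : Prime p → ¬ (+ p ∣ det A) → A ^ᴹ p ≋ A [mod p ] ⊎ A ^ᴹ p ≋ adj A [mod p ] →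
                A ^ᴹ ((p ∸ 1) ℕ.* suc p) ≋ I₂ [mod p ]
  ^ᴹ[p²-1]≋I₂ {zero} pp = ⊥-elim (¬prime[0] pp)
  ^ᴹ[p²-1]≋I₂ {p@(suc q)} {A} pp p∤detA (inj₁ Aᵖ≋A) = begin
    A ^ᴹ (q ℕ.* suc p)    ≡⟨ cong (A ^ᴹ_) (ℕ.*-comm q (suc p)) ⟩
    A ^ᴹ (suc p ℕ.* q)    ≡⟨ ^ᴹ-* A (suc p) q ⟩
    (A ^ᴹ q) ^ᴹ suc p     ≈⟨ ^ᴹ-≋I₂ (suc p) Aᵠ≋I₂ ⟩
    I₂                    ∎
    where
    open ≋-Reasoning
    Aᵠ≋I₂ : A ^ᴹ q ≋ I₂ [mod p ]
    Aᵠ≋I₂ = ⊗-cancelʳ pp p∤detA (begin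
      (A ^ᴹ q) ⊗ A  ≡⟨ ^ᴹ-suc A q ⟨
      A ^ᴹ p        ≈⟨ Aᵖ≋A ⟩
      A             ≡⟨ M₂.*-identityˡ A ⟨
      I₂ ⊗ A        ∎)
  ^ᴹ[p²-1]≋I₂ {p@(suc q)} {A} pp p∤detA (inj₂ Aᵖ≋adjA) = begin
    A ^ᴹ (q ℕ.* suc p)          ≡⟨ ^ᴹ-* A q (suc p) ⟩
    (A ^ᴹ suc p) ^ᴹ q           ≈⟨ ^ᴹ-cong-mod q Aᵖ⁺¹≋detA ⟩
    scalar (det A) ^ᴹ q         ≡⟨ scalar-^ᴹ (det A) q ⟩
    scalar (det A ^ q)          ≈⟨ scalar-cong-mod (fermat-∤ pp p∤detA) ⟩
    I₂                          ∎
    where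
    open ≋-Reasoning
    Aᵖ⁺¹≋detA : A ^ᴹ suc p ≋ scalar (det A) [mod p ]
    Aᵖ⁺¹≋detA = begin
      A ^ᴹ suc p       ≡⟨ ^ᴹ-suc A p ⟩
      (A ^ᴹ p) ⊗ A     ≈⟨ ⊗-cong-mod Aᵖ≋adjA (≋-reflexive refl) ⟩
      adj A ⊗ A        ≡⟨ adj-⊗ A ⟩
      scalar (det A)   ∎

  -- Lifting from p to pⁿ

  geometric : Mat2 → ℕ → Mat2
  geometric B zero    = O₂
  geometric B (suc i) = I₂ ⊕ B ⊗ geometric B i

  ^ᴹ≡I₂⊕⊗geometric : ∀ B X → B ≡ I₂ ⊕ X → ∀ i → B ^ᴹ i ≡ I₂ ⊕ X ⊗ geometric B i
  ^ᴹ≡I₂⊕⊗geometric B X B≡I₂⊕X zero    = ≡.sym (≡.trans (cong (I₂ ⊕_) (M₂.zeroʳ X)) (M₂.+-identityʳ I₂))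
  ^ᴹ≡I₂⊕⊗geometric B X B≡I₂⊕X (suc i) = begin
    B ⊗ (B ^ᴹ i)                      ≡⟨ cong (B ⊗_) (^ᴹ≡I₂⊕⊗geometric B X B≡I₂⊕X i) ⟩
    B ⊗ (I₂ ⊕ X ⊗ G)                  ≡⟨ M₂.distribˡ B I₂ (X ⊗ G) ⟩
    B ⊗ I₂ ⊕ B ⊗ (X ⊗ G)              ≡⟨ cong₂ _⊕_ (M₂.*-identityʳ B) (≡.sym (M₂.*-assoc B X G)) ⟩
    B ⊕ (B ⊗ X) ⊗ G                   ≡⟨ cong₂ _⊕_ B≡I₂⊕X (cong (_⊗ G) BX≡XB) ⟩
    (I₂ ⊕ X) ⊕ (X ⊗ B) ⊗ G            ≡⟨ cong ((I₂ ⊕ X) ⊕_) (M₂.*-assoc X B G) ⟩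
    (I₂ ⊕ X) ⊕ X ⊗ (B ⊗ G)            ≡⟨ M₂.+-assoc I₂ X (X ⊗ (B ⊗ G)) ⟩
    I₂ ⊕ (X ⊕ X ⊗ (B ⊗ G))            ≡⟨ cong (λ Y → I₂ ⊕ (Y ⊕ X ⊗ (B ⊗ G))) (M₂.*-identityʳ X) ⟨
    I₂ ⊕ (X ⊗ I₂ ⊕ X ⊗ (B ⊗ G))       ≡⟨ cong (I₂ ⊕_) (M₂.distribˡ X I₂ (B ⊗ G)) ⟨
    I₂ ⊕ X ⊗ (I₂ ⊕ B ⊗ G)             ∎
    where
    open ≡.≡-Reasoning
    G = geometric B i
    BX≡XB : B ⊗ X ≡ X ⊗ B
    BX≡XB = begin
      B ⊗ X              ≡⟨ cong (_⊗ X) B≡I₂⊕X ⟩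
      (I₂ ⊕ X) ⊗ X       ≡⟨ M₂.distribʳ X I₂ X ⟩
      I₂ ⊗ X ⊕ X ⊗ X     ≡⟨ cong (_⊕ X ⊗ X) (≡.trans (M₂.*-identityˡ X) (≡.sym (M₂.*-identityʳ X))) ⟩
      X ⊗ I₂ ⊕ X ⊗ X     ≡⟨ M₂.distribˡ X I₂ X ⟨
      X ⊗ (I₂ ⊕ X)       ≡⟨ cong (X ⊗_) B≡I₂⊕X ⟨
      X ⊗ B              ∎

  geometric-≋ : B ≋ I₂ [mod m ] → ∀ i → geometric B i ≋ scalar (+ i) [mod m ]
  geometric-≋ B≋I₂ zero    = ≋-reflexive refl
  geometric-≋ {B} B≋I₂ (suc i) = begin
    I₂ ⊕ B ⊗ geometric B i     ≈⟨ ⊕-cong-mod (≋-reflexive {A = I₂} refl)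
                                             (⊗-cong-mod B≋I₂ (geometric-≋ B≋I₂ i)) ⟩
    I₂ ⊕ I₂ ⊗ scalar (+ i)     ≡⟨ cong (I₂ ⊕_) (M₂.*-identityˡ (scalar (+ i))) ⟩
    scalar (+ suc i)           ∎
    where open ≋-Reasoning

  -- Bⁿ − I₂ = (B − I₂)·(geometric B n), where B − I₂ ≡ 0 (mod m) and
  -- geometric B n ≡ n·I₂ ≡ 0 (mod n).
  lift-≋I₂ : B ≋ I₂ [mod m ] → B ≋ I₂ [mod n ] → B ^ᴹ n ≋ I₂ [mod m ℕ.* n ]
  lift-≋I₂ {B} {m} {n} B≋I₂[m] B≋I₂[n] = begin
    B ^ᴹ n                  ≡⟨ ^ᴹ≡I₂⊕⊗geometric B Δ B≡I₂⊕Δ n ⟩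
    I₂ ⊕ Δ ⊗ geometric B n  ≈⟨ ⊕-cong-mod (≋-reflexive {A = I₂} refl) (⊗-≋O₂ Δ≋O₂ Gₙ≋O₂) ⟩
    I₂ ⊕ O₂                 ≡⟨ M₂.+-identityʳ I₂ ⟩
    I₂                      ∎
    where
    open ≋-Reasoning
    Δ = mat (a B - 1ℤ) (b B) (c B) (d B - 1ℤ)
    B≡I₂⊕Δ : B ≡ I₂ ⊕ Δ
    B≡I₂⊕Δ = mat-≡ (x≡1+[x-1] (a B)) (≡.sym (ℤ.+-identityˡ (b B)))
                   (≡.sym (ℤ.+-identityˡ (c B))) (x≡1+[x-1] (d B))
      where
      x≡1+[x-1] : ∀ x → x ≡ 1ℤ + (x - 1ℤ)
      x≡1+[x-1] = solve-∀
    Δ≋O₂ : Δ ≋ O₂ [mod m ]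
    Δ≋O₂ = let entrywise a∼ b∼ c∼ d∼ = B≋I₂[m] in
      entrywise (∣⇒∼0 (∣-difference a∼)) b∼ c∼ (∣⇒∼0 (∣-difference d∼))
    Gₙ≋O₂ : geometric B n ≋ O₂ [mod n ]
    Gₙ≋O₂ = M₂/.trans (geometric-≋ B≋I₂[n] n) (scalar-cong-mod (∣⇒∼0 ∣-refl))

  ^ᴹ[mⁱ]≋I₂ : B ≋ I₂ [mod m ] → ∀ i → B ^ᴹ (m ℕ.^ i) ≋ I₂ [mod m ℕ.^ suc i ]
  ^ᴹ[mⁱ]≋I₂ {B} {m} B≋I₂ zero =
    subst (B ^ᴹ 1 ≋ I₂ [mod_]) (≡.sym (ℕ.*-identityʳ m)) (M₂/.trans (≋-reflexive (M₂.*-identityʳ B)) B≋I₂)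
  ^ᴹ[mⁱ]≋I₂ {B} {m} B≋I₂ (suc i) =
    M₂/.trans (≋-reflexive (^ᴹ-* B m (m ℕ.^ i)))
      (subst ((B ^ᴹ (m ℕ.^ i)) ^ᴹ m ≋ I₂ [mod_]) (ℕ.*-comm (m ℕ.^ suc i) m)
        (lift-≋I₂ (^ᴹ[mⁱ]≋I₂ B≋I₂ i) (^ᴹ-≋I₂ (m ℕ.^ i) B≋I₂)))

  order-∣ : IsOrder m A k → A ^ᴹ j ≋ I₂ [mod m ] → k ℕ.∣ j
  order-∣ {k = zero} (() , _)
  order-∣ {m} {A} {suc k} {j} (_ , Aᵏ≈I₂ , minimal) Aʲ≋I₂ =
    ℕ.m%n≡0⇒n∣m j (suc k) (remainder≡0 ρ (m%n<n j (suc k)) Aᵨ≋I₂)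
    where
    open ≋-Reasoning
    ρ = j ℕ.% suc k
    q = j ℕ./ suc k
    Aʲ≡AᵨAᵏ^q : A ^ᴹ j ≡ (A ^ᴹ ρ) ⊗ ((A ^ᴹ suc k) ^ᴹ q)
    Aʲ≡AᵨAᵏ^q = ≡.trans (cong (A ^ᴹ_) (m≡m%n+[m/n]*n j (suc k)))
                  (≡.trans (^ᴹ-+ A ρ (q ℕ.* suc k)) (cong ((A ^ᴹ ρ) ⊗_) (^ᴹ-* A q (suc k))))
    Aᵨ≋I₂ : A ^ᴹ ρ ≋ I₂ [mod m ]
    Aᵨ≋I₂ = begin
      A ^ᴹ ρ                              ≡⟨ M₂.*-identityʳ (A ^ᴹ ρ) ⟨
      (A ^ᴹ ρ) ⊗ I₂                       ≈⟨ ⊗-cong-mod (≋-reflexive {A = A ^ᴹ ρ} refl)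
                                                      (M₂/.sym (^ᴹ-≋I₂ q (≈[mod]⇒≋ Aᵏ≈I₂))) ⟩
      (A ^ᴹ ρ) ⊗ ((A ^ᴹ suc k) ^ᴹ q)      ≡⟨ Aʲ≡AᵨAᵏ^q ⟨
      A ^ᴹ j                              ≈⟨ Aʲ≋I₂ ⟩
      I₂                                  ∎
    remainder≡0 : ∀ i → i ℕ.< suc k → A ^ᴹ i ≋ I₂ [mod m ] → i ≡ 0
    remainder≡0 zero    _   _     = refl
    remainder≡0 (suc i) i<k Aⁱ≋I₂ = ⊥-elim (minimal (suc i) (s≤s z≤n) i<k (≋⇒≈[mod] Aⁱ≋I₂))

  square-mod-2 : ∀ x → IsSquareMod 2 x
  square-mod-2 x = x , ∼⇒≡[mod] x²∼x
    where
    x²∼x : x * x ∼ x [mod 2 ]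
    x²∼x = ∼-trans (∼-reflexive (cong (x *_) (≡.sym (ℤ.*-identityʳ x)))) (fermat prime[2] x)

  -- h = r + 1 is the inverse of 2 modulo p.
  half-square : p ≡ suc (r ℕ.+ r) → + p ∣ x * x - + 4 * y → (x * + suc r) * (x * + suc r) ∼ y [mod p ]
  half-square {p = p} {r = r} {x = x} {y = y} refl p∣x²-4y = mod-∣ (subst (_ ∣_) (≡.sym eq)
    (∣m∣n⇒∣m+n (∣n⇒∣m*n (h * h) p∣x²-4y) (∣n⇒∣m*n (y * (+ 2 * h + 1ℤ)) (subst (+ p ∣_) p≡2h-1 ∣-refl))))
    where
    h = + suc r
    p≡2h-1 : + p ≡ + 2 * h - 1ℤ
    p≡2h-1 = 1+[z+z]≡2[1+z]-1 (+ r)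
      where
      1+[z+z]≡2[1+z]-1 : ∀ z → 1ℤ + (z + z) ≡ + 2 * (1ℤ + z) - 1ℤ
      1+[z+z]≡2[1+z]-1 = solve-∀
    eq : (x * h) * (x * h) - y ≡ h * h * (x * x - + 4 * y) + y * (+ 2 * h + 1ℤ) * (+ 2 * h - 1ℤ)
    eq = identity x y h
      where
      identity : ∀ x y h →
                 (x * h) * (x * h) - y ≡ h * h * (x * x - + 4 * y) + y * (+ 2 * h + 1ℤ) * (+ 2 * h - 1ℤ)
      identity = solve-∀

  square⊎^ᴹ[p²-1]≋I₂ : Prime p → p ≡ suc (r ℕ.+ r) → det A * x ∼ 1ℤ [mod p ] →
                       IsSquareMod p (det A) ⊎ A ^ᴹ ((p ∸ 1) ℕ.* suc p) ≋ I₂ [mod p ]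
  square⊎^ᴹ[p²-1]≋I₂ {p} {r} {A} pp p-odd detA-unit with + p ∣? disc A
  ... | yes p∣D = inj₁ (tr A * + suc r , ∼⇒≡[mod] (half-square {x = tr A} {y = det A} p-odd p∣D))
  ... | no  p∤D = inj₂ (^ᴹ[p²-1]≋I₂ pp (unit⇒∤ pp detA-unit) (frobenius-2×2 {r = r} pp p-odd p∤D))

open import Data.Nat using (ℕ; _≤_; _+_; _^_; _*_; _∸_)
open import Data.Nat.Divisibility using (_∣_)

even⊎odd : ∀ n → ∃ λ r → n ≡ r + r ⊎ n ≡ suc (r + r)
even⊎odd zero    = 0 , inj₁ refl
even⊎odd (suc n) with even⊎odd n
... | r , inj₁ refl = r , inj₂ refl
... | r , inj₂ refl = suc r , inj₁ (cong suc (≡.sym (ℕ.+-suc r r)))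

2∣n+n : ∀ n → 2 ∣ n + n
2∣n+n n = ℕ.divides n (≡.trans (cong (n +_) (≡.sym (ℕ.+-identityʳ n))) (ℕ.*-comm 2 n))

prime⇒2⊎odd : Prime p → p ≡ 2 ⊎ ∃ λ r → p ≡ suc (r + r)
prime⇒2⊎odd pp with even⊎odd _
... | r , inj₂ p-odd  = inj₂ (r , p-odd)
... | r , inj₁ refl with prime⇒irreducible pp (2∣n+n r)
...   | inj₁ ()
...   | inj₂ 2≡p = inj₁ (≡.sym 2≡p)

prime∤[p-1][p+1] : Prime p → ¬ p ∣ (p ∸ 1) * suc p
prime∤[p-1][p+1] {zero}  pp = ⊥-elim (¬prime[0] pp)
prime∤[p-1][p+1] {suc q} pp p∣[p-1][p+1] with euclidsLemma q (suc (suc q)) pp p∣[p-1][p+1]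
... | inj₁ p∣q   = ℕ.<⇒≱ (ℕ.n<1+n q) (ℕ.∣⇒≤ {{ℕ.>-nonZero (ℕ.s<s⁻¹ (prime>1 pp))}} p∣q)
... | inj₂ p∣p+1 = ℕ.<⇒≢ (prime>1 pp) (≡.sym (ℕ.∣1⇒≡1 p∣1))
  where
  p∣1 : suc q ∣ 1
  p∣1 = ℕ.∣m+n∣m⇒∣n (subst (suc q ∣_) (ℕ.+-comm 1 (suc q)) p∣p+1) ℕ.∣-refl

lemma3p5 : (p n : ℕ) → Prime p → 1 ≤ n →
    (A : Mat2) → InGL2 (p ^ n) A →
    (k : ℕ) → IsOrder (p ^ n) A k →
    (p ^ n) * (p ∸ 1) ∣ k →
    IsSquareMod p (det A)
lemma3p5 p zero    pp ()
lemma3p5 p (suc n) pp _ A (_ , detA·u≡1) k order pⁿ[p-1]∣k with prime⇒2⊎odd pp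
... | inj₁ refl = square-mod-2 (det A)
... | inj₂ (r , p-odd)
  with square⊎^ᴹ[p²-1]≋I₂ {r = r} {A = A} pp p-odd (∼-weaken (ℕ.m∣m*n (p ^ n)) (≡[mod]⇒∼ detA·u≡1))
...   | inj₁ square = square
...   | inj₂ A^[p²-1]≋I₂ = ⊥-elim (prime∤[p-1][p+1] pp p∣[p-1][p+1])
  where
  instance _ = ℕ.m^n≢0 p n {{prime⇒nonZero pp}}
  k∣pⁿ[p²-1] : k ∣ p ^ n * ((p ∸ 1) * suc p)
  k∣pⁿ[p²-1] = order-∣ order (M₂/.trans (≋-reflexive (^ᴹ-* A (p ^ n) _)) (^ᴹ[mⁱ]≋I₂ A^[p²-1]≋I₂ n))
  p∣[p-1][p+1] : p ∣ (p ∸ 1) * suc p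
  p∣[p-1][p+1] = ℕ.*-cancelˡ-∣ (p ^ n) (subst (_∣ p ^ n * ((p ∸ 1) * suc p)) (ℕ.*-comm p (p ^ n))
    (ℕ.∣-trans (ℕ.∣-trans (ℕ.m∣m*n (p ∸ 1)) pⁿ[p-1]∣k) k∣pⁿ[p²-1]))
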